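{- Let $G=(V,E)\in\mathfrak{Gr}(n,k)$ and let $s$ be an integer with $0\le s\le n$. If $S$ is a subset of $V$ of size $s$ chosen uniformly at random, then $$\mathbb{P}(S\text{ is identifying in }G)\ge 1-\binom{n+1}{2}\frac{\binom{k-1}{s}}{\binom{n}{s}}.$$
   Context: All graphs are finite, simple and undirected. For a graph $G=(V,E)$ and $x\in V$, $N[x]=\{x\}\cup\{y: xy\in E\}$. A set $C\subseteq V$ is identifying if $N[x]\cap C\ne\emptyset$ for every $x\in V$ and $N[x]\cap C\neq N[y]\cap C$ for all distinct $x,y\in V$. For $n\ge k\ge1$, $\mathfrak{Gr}(n,k)$ is the set of graphs on $n$ vertices in which every $k$-element subset of vertices is identifying. -}

module Defs where

open import Data.Bool using (Bool; true; false)
open import Data.Nat using (ℕ; zero; suc; _≤_)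
import Data.Nat as ℕ
open import Data.Fin using (Fin)
open import Data.Fin.Properties using (all?)
open import Data.Fin.Subset using (Subset; inside; outside; _∩_; Nonempty; ∣_∣)
open import Data.Fin.Subset.Properties using (nonempty?)
open import Data.Vec using (Vec; []; _∷_; tabulate)
open import Data.Vec.Properties using (≡-dec)
import Data.Bool.Properties as BoolP
open import Data.List using (List; []; _∷_; _++_; map; filter; length)
open import Data.Product using (_×_)
open import Relation.Nullary using (Dec; yes; no; ¬_)
open import Relation.Nullary.Decidable using (_×-dec_; ¬?; _→-dec_)
open import Relation.Binary.PropositionalEquality using (_≡_; _≢_)
import Data.Fin.Properties as FinP

record Graph (n : ℕ) : Set where
  field
    adj     : Fin n → Fin n → Bool
    symm    : ∀ x y → adj x y ≡ adj y x
    irrefl  : ∀ x → adj x x ≡ false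
open Graph public

N[_] : ∀ {n} {G : Graph n} → Fin n → Subset n
N[_] {n} {G} x = tabulate λ y → member y
  where
  member : Fin n → Bool
  member y with FinP._≟_ x y
  ... | yes _ = true
  ... | no  _ = adj G x y

closedNbhd : ∀ {n} (G : Graph n) → Fin n → Subset n
closedNbhd G x = N[_] {G = G} x

Identifying : ∀ {n} (G : Graph n) → Subset n → Set
Identifying {n} G C =
  ((x : Fin n) → Nonempty (closedNbhd G x ∩ C)) ×
  ((x y : Fin n) → x ≢ y → closedNbhd G x ∩ C ≢ closedNbhd G y ∩ C)

InGr : ∀ (n k : ℕ) → Graph n → Set
InGr n k G = (1 ≤ k) × (k ≤ n) × ((C : Subset n) → ∣ C ∣ ≡ k → Identifying G C)

identifying? : ∀ {n} (G : Graph n) (C : Subset n) → Dec (Identifying G C)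
identifying? G C =
  all? (λ x → nonempty? (closedNbhd G x ∩ C)) ×-dec
  all? (λ x → all? (λ y → ¬? (FinP._≟_ x y) →-dec
                           ¬? (≡-dec BoolP._≟_ (closedNbhd G x ∩ C) (closedNbhd G y ∩ C))))

allSubsets : ∀ n → List (Subset n)
allSubsets zero    = [] ∷ []
allSubsets (suc n) = map (inside ∷_) (allSubsets n) ++ map (outside ∷_) (allSubsets n)

#identifyingOfSize : ∀ {n} (G : Graph n) (s : ℕ) → ℕ
#identifyingOfSize {n} G s =
  length (filter (λ C → (ℕ._≟_ ∣ C ∣ s) ×-dec identifying? G C) (allSubsets n))

-- An s-set S fails to be identifying exactly when some pair of distinct vertices of
-- V ∪ {∞}, where N[∞] = ∅, is not separated by S, i.e. when S lies inside the set of
-- vertices that see both members of the pair or neither. There are C(n+1,2) such pairs,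
-- and each of these agreement sets has fewer than k elements, since otherwise one of its
-- k-subsets would be a non-identifying k-set. So each pair spoils at most C(k-1,s) of the
-- C(n,s) s-sets, and a union bound gives the theorem.
module Submission where

open import Defs
open import Data.Nat using (ℕ; _≤_; _+_; _*_; _≥_; _∸_)
open import Data.Nat.Combinatorics using (_C_)
open import Data.Fin.Subset using (Subset)

open import Data.Bool using (true; false; not; _xor_; _∧_)
open import Data.Bool.Properties using (∧-zeroʳ)
open import Data.Nat using (zero; suc; _<_; z≤n; s≤s; s≤s⁻¹; _≤′_; ≤′-refl; ≤′-step)
open import Data.Nat.Properties
open import Data.Nat.Combinatorics using (nCk+nC[k+1]≡[n+1]C[k+1]; nC1≡n)
open import Data.Nat.ListAction using (sum)
open import Data.Fin using (Fin; zero; suc)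
import Data.Fin.Properties as Fin
open import Data.Fin.Subset using (_⊆_; _∈_; _∩_; ⊥; ⊤; ∣_∣; Nonempty; inside; outside)
open import Data.Fin.Subset.Properties
  using (_⊆?_; drop-∷-⊆; out⊆; in⊆in; ∉⊥; Empty-unique; nonempty?; ∩-zeroˡ; ∣⊤∣≡n; ⊆⊤)
open import Data.Vec using (_∷_; []; zipWith; here; there)
open import Data.Vec.Properties using (∷-injectiveˡ; ∷-injectiveʳ)
open import Data.List using (List; []; _∷_; _++_; map; filter; length; allFin)
open import Data.List.Properties using (filter-≐; filter-none; filter-++; length-++; length-map; length-tabulate)
open import Data.List.Relation.Unary.All as All using (All)
open import Data.List.Relation.Unary.All.Properties using (++⁺; map⁺)
open import Data.List.Relation.Unary.Any as Any using (Any; any?)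
open import Data.List.Membership.Propositional using () renaming (_∈_ to _∈ₗ_)
open import Data.List.Membership.Propositional.Properties using (∈-map⁺; ∈-++⁺ˡ; ∈-++⁺ʳ; ∈-allFin)
open import Data.Product using (_×_; _,_; proj₁; proj₂; ∃; map₂)
import Data.Product as Product
open import Data.Sum using (_⊎_; inj₁; inj₂)
import Data.Sum as Sum
open import Function using (_∘_; _⇔_; mk⇔; Equivalence; case_of_)
open import Level using (Level)
open import Relation.Nullary using (yes; no; ¬_; contradiction)
open import Relation.Unary using (Pred; Decidable; _≐_; IUniversal; _⇒_)
open import Relation.Unary.Properties using (_∪?_; _∩?_)
open import Relation.Binary.PropositionalEquality

private variable
  a b p q r : Level
  A : Set a

count : {P : Pred A p} → Decidable P → List A → ℕ
count P? = length ∘ filter P?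

module _ {P : Pred A p} (P? : Decidable P) where

  count-++ : ∀ xs ys → count P? (xs ++ ys) ≡ count P? xs + count P? ys
  count-++ xs ys = trans (cong length (filter-++ P? xs ys)) (length-++ (filter P? xs))

  count-none : (∀ x → ¬ P x) → ∀ xs → count P? xs ≡ 0
  count-none ¬P xs = cong length (filter-none P? (All.universal ¬P xs))

  count-witness : ∀ xs → 0 < count P? xs → ∃ P
  count-witness (x ∷ xs) pos with P? x
  ... | yes Px = x , Px
  ... | no  _  = count-witness xs pos

  count-map : {B : Set b} (f : B → A) → ∀ xs → count P? (map f xs) ≡ count (P? ∘ f) xs
  count-map f [] = refl
  count-map f (x ∷ xs) with P? (f x)
  ... | yes _ = cong suc (count-map f xs)
  ... | no  _ = count-map f xs

module _ {P : Pred A p} {Q : Pred A q} (P? : Decidable P) (Q? : Decidable Q) where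

  count-mono : ∀[ P ⇒ Q ] → ∀ xs → count P? xs ≤ count Q? xs
  count-mono P⇒Q [] = z≤n
  count-mono P⇒Q (x ∷ xs) with P? x | Q? x
  ... | yes _  | yes _  = s≤s (count-mono P⇒Q xs)
  ... | yes Px | no ¬Qx = contradiction (P⇒Q Px) ¬Qx
  ... | no  _  | yes _  = m≤n⇒m≤1+n (count-mono P⇒Q xs)
  ... | no  _  | no  _  = count-mono P⇒Q xs

  count-≐ : P ≐ Q → ∀ xs → count P? xs ≡ count Q? xs
  count-≐ P≐Q xs = cong length (filter-≐ P? Q? P≐Q xs)

  count-∪ : ∀ xs → count (P? ∪? Q?) xs ≤ count P? xs + count Q? xs
  count-∪ [] = z≤n
  count-∪ (x ∷ xs) with P? x | Q? x
  ... | yes _ | yes _ = s≤s (≤-trans (count-∪ xs) (+-monoʳ-≤ (count P? xs) (n≤1+n _)))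
  ... | yes _ | no  _ = s≤s (count-∪ xs)
  ... | no  _ | yes _ = ≤-trans (s≤s (count-∪ xs)) (≤-reflexive (sym (+-suc _ _)))
  ... | no  _ | no  _ = count-∪ xs

module _ {C : Set b} {R : C → Pred A r} (R? : ∀ c → Decidable (R c)) where

  count-Any : ∀ cs xs → count (λ x → any? (λ c → R? c x) cs) xs ≤ sum (map (λ c → count (R? c) xs) cs)
  count-Any []       xs = ≤-reflexive (count-none _ (λ _ ()) xs)
  count-Any (c ∷ cs) xs = begin
    count (λ x → any? (λ c → R? c x) (c ∷ cs)) xs
      ≤⟨ count-mono _ (R? c ∪? anyR?) Any.toSum xs ⟩
    count (R? c ∪? anyR?) xs
      ≤⟨ count-∪ (R? c) anyR? xs ⟩
    count (R? c) xs + count anyR? xs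
      ≤⟨ +-monoʳ-≤ (count (R? c) xs) (count-Any cs xs) ⟩
    sum (map (λ c → count (R? c) xs) (c ∷ cs)) ∎
    where
    open ≤-Reasoning
    anyR? : Decidable (λ x → Any (λ c → R c x) cs)
    anyR? x = any? (λ c → R? c x) cs

sum-map-≤ : {C : Set a} (g : C → ℕ) {M : ℕ} → ∀ {cs} →
            All (λ c → g c ≤ M) cs → sum (map g cs) ≤ length cs * M
sum-map-≤ g All.[]         = z≤n
sum-map-≤ g (gc≤M All.∷ h) = +-mono-≤ gc≤M (sum-map-≤ g h)

nCk≤[1+n]Ck : ∀ n k → n C k ≤ suc n C k
nCk≤[1+n]Ck n zero    = ≤-refl
nCk≤[1+n]Ck n (suc k) = ≤-trans (m≤n+m (n C suc k) (n C k)) (≤-reflexive (nCk+nC[k+1]≡[n+1]C[k+1] n k))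

m≤n⇒mCk≤nCk : ∀ {m n} k → m ≤ n → m C k ≤ n C k
m≤n⇒mCk≤nCk k = go ∘ ≤⇒≤′
  where
  go : ∀ {m n} → m ≤′ n → m C k ≤ n C k
  go ≤′-refl       = ≤-refl
  go (≤′-step m≤n) = ≤-trans (go m≤n) (nCk≤[1+n]Ck _ k)

k≤n⇒nCk>0 : ∀ {k n} → k ≤ n → 0 < n C k
k≤n⇒nCk>0 {zero}          _         = s≤s z≤n
k≤n⇒nCk>0 {suc k} {suc n} (s≤s k≤n) =
  ≤-trans (k≤n⇒nCk>0 k≤n) (≤-trans (m≤m+n (n C k) (n C suc k)) (≤-reflexive (nCk+nC[k+1]≡[n+1]C[k+1] n k)))

ofSize? : ∀ {n} s → Decidable (λ (S : Subset n) → ∣ S ∣ ≡ s)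
ofSize? s S = ∣ S ∣ ≟ s

count-subsetsOfSize : ∀ {n} (B : Subset n) s → count (ofSize? s ∩? (_⊆? B)) (allSubsets n) ≡ ∣ B ∣ C s
count-subsetsOfSize {zero}  [] zero    = refl
count-subsetsOfSize {zero}  [] (suc s) = refl
count-subsetsOfSize {suc n} (b ∷ B) s = begin
  count P? (map (inside ∷_) L ++ map (outside ∷_) L)
    ≡⟨ count-++ P? (map (inside ∷_) L) (map (outside ∷_) L) ⟩
  count P? (map (inside ∷_) L) + count P? (map (outside ∷_) L)
    ≡⟨ cong₂ _+_ (count-map P? (inside ∷_) L) (count-map P? (outside ∷_) L) ⟩
  count (P? ∘ (inside ∷_)) L + count (P? ∘ (outside ∷_)) L
    ≡⟨ cong (count (P? ∘ (inside ∷_)) L +_) outside-part ⟩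
  count (P? ∘ (inside ∷_)) L + ∣ B ∣ C s
    ≡⟨ inside-part b s ⟩
  ∣ b ∷ B ∣ C s ∎
  where
  open ≡-Reasoning
  L = allSubsets n
  P? = ofSize? s ∩? (_⊆? (b ∷ B))
  outside-part : count (P? ∘ (outside ∷_)) L ≡ ∣ B ∣ C s
  outside-part = trans (count-≐ _ (ofSize? s ∩? (_⊆? B))
                          (map₂ drop-∷-⊆ , map₂ out⊆) L)
                       (count-subsetsOfSize B s)
  inside-part : ∀ b s → count ((ofSize? s ∩? (_⊆? (b ∷ B))) ∘ (inside ∷_)) L + ∣ B ∣ C s ≡ ∣ b ∷ B ∣ C s
  inside-part outside s = cong (_+ ∣ B ∣ C s) (count-none _ (λ _ (_ , h) → case h here of λ ()) L)
  inside-part inside zero = cong (_+ 1) (count-none _ (λ _ ()) L)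
  inside-part inside (suc s) = begin
    count ((ofSize? (suc s) ∩? (_⊆? (inside ∷ B))) ∘ (inside ∷_)) L + ∣ B ∣ C suc s
      ≡⟨ cong (_+ ∣ B ∣ C suc s) (count-≐ _ (ofSize? s ∩? (_⊆? B))
           (Product.map suc-injective drop-∷-⊆ , Product.map (cong suc) in⊆in) L) ⟩
    count (ofSize? s ∩? (_⊆? B)) L + ∣ B ∣ C suc s
      ≡⟨ cong (_+ ∣ B ∣ C suc s) (count-subsetsOfSize B s) ⟩
    ∣ B ∣ C s + ∣ B ∣ C suc s
      ≡⟨ nCk+nC[k+1]≡[n+1]C[k+1] ∣ B ∣ s ⟩
    ∣ inside ∷ B ∣ C suc s ∎

count-ofSize : ∀ n s → count (ofSize? s) (allSubsets n) ≡ n C s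
count-ofSize n s = begin
  count (ofSize? s) (allSubsets n)
    ≡⟨ count-≐ _ (ofSize? s ∩? (_⊆? ⊤)) ((_, ⊆⊤) , proj₁) (allSubsets n) ⟩
  count (ofSize? s ∩? (_⊆? ⊤)) (allSubsets n)
    ≡⟨ count-subsetsOfSize (⊤ {n}) s ⟩
  ∣ ⊤ {n} ∣ C s
    ≡⟨ cong (_C s) (∣⊤∣≡n n) ⟩
  n C s ∎
  where open ≡-Reasoning

k≤∣B∣⇒∃subsetOfSize : ∀ {n k} (B : Subset n) → k ≤ ∣ B ∣ → ∃ λ S → ∣ S ∣ ≡ k × S ⊆ B
k≤∣B∣⇒∃subsetOfSize {n} {k} B k≤∣B∣ =
  count-witness (ofSize? k ∩? (_⊆? B)) (allSubsets n)
    (subst (0 <_) (sym (count-subsetsOfSize B k)) (k≤n⇒nCk>0 k≤∣B∣))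

Nonempty⇔≢⊥ : ∀ {n} {S : Subset n} → Nonempty S ⇔ S ≢ ⊥
Nonempty⇔≢⊥ {S = S} = mk⇔ (λ (x , x∈S) S≡⊥ → ∉⊥ (subst (x ∈_) S≡⊥ x∈S)) ≢⊥⇒Nonempty
  where
  ≢⊥⇒Nonempty : S ≢ ⊥ → Nonempty S
  ≢⊥⇒Nonempty S≢⊥ with nonempty? S
  ... | yes ne = ne
  ... | no  ¬ne = contradiction (Empty-unique ¬ne) S≢⊥

agreement : ∀ {n} → Subset n → Subset n → Subset n
agreement = zipWith λ a b → not (a xor b)

⊆-agreement⇒∩≡ : ∀ {n} (A B S : Subset n) → S ⊆ agreement A B → A ∩ S ≡ B ∩ S
⊆-agreement⇒∩≡ [] [] [] _ = refl
⊆-agreement⇒∩≡ (a ∷ A) (b ∷ B) (outside ∷ S) S⊆ =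
  cong₂ _∷_ (trans (∧-zeroʳ a) (sym (∧-zeroʳ b))) (⊆-agreement⇒∩≡ A B S (drop-∷-⊆ S⊆))
⊆-agreement⇒∩≡ (a ∷ A) (b ∷ B) (inside ∷ S) S⊆ =
  cong₂ _∷_ (agree a b (S⊆ here)) (⊆-agreement⇒∩≡ A B S (drop-∷-⊆ S⊆))
  where
  agree : ∀ a b → zero ∈ (not (a xor b) ∷ agreement A B) → a ∧ inside ≡ b ∧ inside
  agree false false _ = refl
  agree true  true  _ = refl

∩≡⇒⊆-agreement : ∀ {n} (A B S : Subset n) → A ∩ S ≡ B ∩ S → S ⊆ agreement A B
∩≡⇒⊆-agreement (a ∷ A) (b ∷ B) (inside ∷ S) eq here = agree a b (∷-injectiveˡ eq)
  where
  agree : ∀ a b → a ∧ inside ≡ b ∧ inside → zero ∈ (not (a xor b) ∷ agreement A B)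
  agree false false _ = here
  agree true  true  _ = here
∩≡⇒⊆-agreement (a ∷ A) (b ∷ B) (_ ∷ S) eq (there x∈S) =
  there (∩≡⇒⊆-agreement A B S (∷-injectiveʳ eq) x∈S)

distinctPairs : ∀ m → List (Fin m × Fin m)
distinctPairs zero    = []
distinctPairs (suc m) = map (λ v → zero , suc v) (allFin m) ++ map (λ (u , v) → suc u , suc v) (distinctPairs m)

length-distinctPairs : ∀ m → length (distinctPairs m) ≡ m C 2
length-distinctPairs zero    = refl
length-distinctPairs (suc m) = begin
  length (map _ (allFin m) ++ map _ (distinctPairs m))
    ≡⟨ length-++ (map _ (allFin m)) ⟩
  length (map _ (allFin m)) + length (map _ (distinctPairs m))
    ≡⟨ cong₂ _+_ (trans (length-map _ (allFin m)) (length-tabulate _))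
                 (trans (length-map _ (distinctPairs m)) (length-distinctPairs m)) ⟩
  m + m C 2
    ≡⟨ cong (_+ m C 2) (sym (nC1≡n m)) ⟩
  m C 1 + m C 2
    ≡⟨ nCk+nC[k+1]≡[n+1]C[k+1] m 1 ⟩
  suc m C 2 ∎
  where open ≡-Reasoning

distinctPairs-distinct : ∀ m → All (λ (u , v) → u ≢ v) (distinctPairs m)
distinctPairs-distinct zero    = All.[]
distinctPairs-distinct (suc m) =
  ++⁺ (map⁺ (All.universal (λ _ ()) (allFin m)))
      (map⁺ (All.map (λ u≢v → u≢v ∘ Fin.suc-injective) (distinctPairs-distinct m)))

distinctPairs-complete : ∀ {m} (u v : Fin m) → u ≢ v →
                         (u , v) ∈ₗ distinctPairs m ⊎ (v , u) ∈ₗ distinctPairs m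
distinctPairs-complete zero    zero    u≢v = contradiction refl u≢v
distinctPairs-complete zero    (suc v) _   = inj₁ (∈-++⁺ˡ (∈-map⁺ _ (∈-allFin v)))
distinctPairs-complete (suc u) zero    _   = inj₂ (∈-++⁺ˡ (∈-map⁺ _ (∈-allFin u)))
distinctPairs-complete {suc m} (suc u) (suc v) u≢v =
  Sum.map lift lift (distinctPairs-complete u v (u≢v ∘ cong suc))
  where
  lift : ∀ {p} → p ∈ₗ distinctPairs m → Product.map suc suc p ∈ₗ distinctPairs (suc m)
  lift = ∈-++⁺ʳ _ ∘ ∈-map⁺ _

module _ {n} (G : Graph n) where

  nbhd⁺ : Fin (suc n) → Subset n
  nbhd⁺ zero    = ⊥
  nbhd⁺ (suc x) = closedNbhd G x

  Separating : Subset n → Set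
  Separating S = ∀ u v → u ≢ v → nbhd⁺ u ∩ S ≢ nbhd⁺ v ∩ S

  identifying⇔separating : ∀ S → Identifying G S ⇔ Separating S
  identifying⇔separating S = mk⇔ separating identifying
    where
    separating : Identifying G S → Separating S
    separating _           zero    zero    u≢v = contradiction refl u≢v
    separating (dom , _)   zero    (suc y) _ eq = Equivalence.to Nonempty⇔≢⊥ (dom y) (trans (sym eq) (∩-zeroˡ S))
    separating (dom , _)   (suc x) zero    _ eq = Equivalence.to Nonempty⇔≢⊥ (dom x) (trans eq (∩-zeroˡ S))
    separating (_ , sep)   (suc x) (suc y) u≢v = sep x y (u≢v ∘ cong suc)
    identifying : Separating S → Identifying G S
    identifying sep =
      (λ x → Equivalence.from Nonempty⇔≢⊥ (sep (suc x) zero (λ ()) ∘ λ eq → trans eq (sym (∩-zeroˡ S)))) ,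
      (λ x y x≢y → sep (suc x) (suc y) (x≢y ∘ Fin.suc-injective))

  Unseparated : Fin (suc n) × Fin (suc n) → Subset n → Set
  Unseparated (u , v) S = S ⊆ agreement (nbhd⁺ u) (nbhd⁺ v)

  ¬identifying⇒unseparatedPair : ∀ S → ¬ Identifying G S → Any (λ c → Unseparated c S) (distinctPairs (suc n))
  ¬identifying⇒unseparatedPair S ¬id
    with any? (λ (u , v) → S ⊆? agreement (nbhd⁺ u) (nbhd⁺ v)) (distinctPairs (suc n))
  ... | yes unsep = unsep
  ... | no  ¬unsep = contradiction (Equivalence.from (identifying⇔separating S) separating) ¬id
    where
    unseparated : ∀ {u v} → nbhd⁺ u ∩ S ≡ nbhd⁺ v ∩ S → ¬ (u , v) ∈ₗ distinctPairs (suc n)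
    unseparated eq = ¬unsep ∘ Any.map λ { refl → ∩≡⇒⊆-agreement _ _ S eq }
    separating : Separating S
    separating u v u≢v eq = Sum.[ unseparated eq , unseparated (sym eq) ] (distinctPairs-complete u v u≢v)

  ∣agreement∣<k : ∀ {k} → InGr n k G → ∀ {u v} → u ≢ v → ∣ agreement (nbhd⁺ u) (nbhd⁺ v) ∣ < k
  ∣agreement∣<k {k} (_ , _ , k-setsIdentifying) {u} {v} u≢v with k ≤? ∣ agreement (nbhd⁺ u) (nbhd⁺ v) ∣
  ... | no  k≰ = ≰⇒> k≰
  ... | yes k≤ =
    let S , ∣S∣≡k , S⊆ = k≤∣B∣⇒∃subsetOfSize _ k≤ in
    contradiction (⊆-agreement⇒∩≡ _ _ S S⊆)
                  (Equivalence.to (identifying⇔separating S) (k-setsIdentifying S ∣S∣≡k) u v u≢v)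

  unseparated? : ∀ s c → Decidable (λ S → ∣ S ∣ ≡ s × Unseparated c S)
  unseparated? s (u , v) = ofSize? s ∩? (_⊆? agreement (nbhd⁺ u) (nbhd⁺ v))

  count-unseparated≤ : ∀ {k} → InGr n (suc k) G → ∀ s {c} → proj₁ c ≢ proj₂ c →
                      count (unseparated? s c) (allSubsets n) ≤ k C s
  count-unseparated≤ inGr s {u , v} u≢v = begin
    count (unseparated? s (u , v)) (allSubsets n)
      ≡⟨ count-subsetsOfSize (agreement (nbhd⁺ u) (nbhd⁺ v)) s ⟩
    ∣ agreement (nbhd⁺ u) (nbhd⁺ v) ∣ C s
      ≤⟨ m≤n⇒mCk≤nCk s (s≤s⁻¹ (∣agreement∣<k inGr u≢v)) ⟩
    _ C s ∎
    where open ≤-Reasoning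

  count-ofSize≤identifying+unseparated : ∀ s →
    count (ofSize? s) (allSubsets n) ≤
    #identifyingOfSize G s + sum (map (λ c → count (unseparated? s c) (allSubsets n)) (distinctPairs (suc n)))
  count-ofSize≤identifying+unseparated s = begin
    count (ofSize? s) L
      ≤⟨ count-mono _ (identifying?ₛ ∪? someUnseparated?) identifying-or-unseparated L ⟩
    count (identifying?ₛ ∪? someUnseparated?) L
      ≤⟨ count-∪ identifying?ₛ someUnseparated? L ⟩
    #identifyingOfSize G s + count someUnseparated? L
      ≤⟨ +-monoʳ-≤ (#identifyingOfSize G s) (count-Any (unseparated? s) (distinctPairs (suc n)) L) ⟩
    #identifyingOfSize G s + sum (map (λ c → count (unseparated? s c) L) (distinctPairs (suc n))) ∎
    where
    open ≤-Reasoning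
    L = allSubsets n
    identifying?ₛ = ofSize? s ∩? identifying? G
    someUnseparated? = λ S → any? (λ c → unseparated? s c S) (distinctPairs (suc n))
    identifying-or-unseparated : ∀ {S} → ∣ S ∣ ≡ s →
      (∣ S ∣ ≡ s × Identifying G S) ⊎ Any (λ c → ∣ S ∣ ≡ s × Unseparated c S) (distinctPairs (suc n))
    identifying-or-unseparated {S} ∣S∣≡s with identifying? G S
    ... | yes id  = inj₁ (∣S∣≡s , id)
    ... | no  ¬id = inj₂ (Any.map (∣S∣≡s ,_) (¬identifying⇒unseparatedPair S ¬id))

-- The bound holds for every s (for s > n, n C s = 0).
theorem31 : (n k : ℕ) (G : Graph n) → InGr n k G →
            (s : ℕ) → s ≤ n →
            #identifyingOfSize G s + ((n + 1) C 2) * ((k ∸ 1) C s) ≥ n C s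
theorem31 n zero    G (() , _) _ _
theorem31 n (suc k) G inGr     s _ = begin
  n C s
    ≡⟨ sym (count-ofSize n s) ⟩
  count (ofSize? s) (allSubsets n)
    ≤⟨ count-ofSize≤identifying+unseparated G s ⟩
  #identifyingOfSize G s + sum (map (λ c → count (unseparated? G s c) (allSubsets n)) pairs)
    ≤⟨ +-monoʳ-≤ (#identifyingOfSize G s)
         (sum-map-≤ _ (All.map (count-unseparated≤ G inGr s) (distinctPairs-distinct (suc n)))) ⟩
  #identifyingOfSize G s + length pairs * (k C s)
    ≡⟨ cong (λ m → #identifyingOfSize G s + m * (k C s))
            (trans (length-distinctPairs (suc n)) (cong (_C 2) (+-comm 1 n))) ⟩
  #identifyingOfSize G s + ((n + 1) C 2) * (k C s) ∎
  where
  open ≤-Reasoning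
  pairs = distinctPairs (suc n)
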